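{- Let $\Gamma, \Delta, \Sigma$ be finite multisets of propositional formulas. If the sequent $\Gamma, \Delta \Rightarrow \Sigma$ is derivable in classical propositional logic (i.e. the disjunction of the formulas in $\Sigma$ is classically derivable from $\Gamma, \Delta$), then the sequent $$\Pi_V, \Gamma, \lnot_\ast \lnot \Delta, \lnot_\ast \Sigma \Rightarrow \ast$$ is derivable in intuitionistic propositional logic, for every set $V$ of propositional variables containing $$(\mathcal{V}^-(\Gamma, \Delta) \cup \mathcal{V}^+(\Sigma)) \cap (\mathcal{V}^+_{ns}(\Gamma) \cup \mathcal{V}^+(\Delta) \cup \mathcal{V}^-(\Sigma)).$$
   Context: Formulas are built from propositional variables and $\bot$ using $\land$, $\lor$, $\rightarrow$; $\lnot A$ abbreviates $A \rightarrow \bot$. The symbol $\ast$ is a distinguished propositional letter (a place holder), and $\lnot_\ast A$ abbreviates $A \rightarrow \ast$. For an operator $c$ (such as $\lnot$ or $\lnot_\ast$) and a multiset $\Gamma = A_1,\dots,A_n$, $c\Gamma$ denotes $cA_1,\dots,cA_n$; so $\lnot_\ast\lnot\Delta$ is the multiset of $(D\rightarrow\bot)\rightarrow\ast$ for $D\in\Delta$. For a set $V$ of propositional variables, $\Pi_V = \{ p \lor \lnot p \mid p \in V\}$. An intuitionistic sequent $\Gamma \Rightarrow C$ is derivable iff $C$ is derivable from the hypotheses $\Gamma$ in intuitionistic propositional logic. The sets $\mathcal{V}^+(A)$, $\mathcal{V}^-(A)$ are defined simultaneously by: $\mathcal{V}^+(p)=\{p\}$, $\mathcal{V}^+(\bot)=\emptyset$,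 $\mathcal{V}^+(A\land B)=\mathcal{V}^+(A\lor B)=\mathcal{V}^+(A)\cup\mathcal{V}^+(B)$, $\mathcal{V}^+(A\rightarrow B)=\mathcal{V}^-(A)\cup\mathcal{V}^+(B)$; $\mathcal{V}^-(p)=\mathcal{V}^-(\bot)=\emptyset$, $\mathcal{V}^-(A\land B)=\mathcal{V}^-(A\lor B)=\mathcal{V}^-(A)\cup\mathcal{V}^-(B)$, $\mathcal{V}^-(A\rightarrow B)=\mathcal{V}^+(A)\cup\mathcal{V}^-(B)$. Also $\mathcal{V}^+_{ns}(p)=\mathcal{V}^+_{ns}(\bot)=\emptyset$, $\mathcal{V}^+_{ns}(A\land B)=\mathcal{V}^+_{ns}(A\lor B)=\mathcal{V}^+_{ns}(A)\cup\mathcal{V}^+_{ns}(B)$, $\mathcal{V}^+_{ns}(A\rightarrow B)=\mathcal{V}^-(A)\cup\mathcal{V}^+_{ns}(B)$. For a finite multiset $\Gamma$, $\mathcal{V}^+(\Gamma)=\bigcup_{B\in\Gamma}\mathcal{V}^+(B)$, and similarly for $\mathcal{V}^-$, $\mathcal{V}^+_{ns}$; $\mathcal{V}^-(\Gamma,\Delta)$ denotes $\mathcal{V}^-$ of the multiset union. -}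

module Defs where

open import Data.Nat using (ℕ)
open import Data.Empty using (⊥)
open import Data.Sum using (_⊎_)
open import Data.Product using (Σ; _×_; ∃)
open import Data.List using (List; []; _∷_)
open import Data.List.Membership.Propositional using (_∈_)
open import Relation.Binary.PropositionalEquality using (_≡_)
open import Relation.Nullary using (¬_)

data Formula : Set where
  var  : ℕ → Formula
  fls  : Formula
  _∧'_ : Formula → Formula → Formula
  _∨'_ : Formula → Formula → Formula
  _⇒_  : Formula → Formula → Formula

infixr 6 _∧'_
infixr 5 _∨'_
infixr 4 _⇒_

neg : Formula → Formula
neg A = A ⇒ fls

-- ¬∗ A := A → ∗   (∗ is given as a formula, in practice a propositional letter)
negS : Formula → Formula → Formula
negS s A = A ⇒ s

-- Sets of hypotheses are predicates on formulas (possibly infinite, e.g. Π_V).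
Hyps : Set₁
Hyps = Formula → Set

_,,_ : Hyps → Formula → Hyps
(H ,, A) B = H B ⊎ B ≡ A

⟦_⟧ : List Formula → Hyps
⟦ Γ ⟧ A = A ∈ Γ

_∪H_ : Hyps → Hyps → Hyps
(H ∪H K) A = H A ⊎ K A

mapH : (Formula → Formula) → List Formula → Hyps
mapH c Γ A = Σ Formula λ B → B ∈ Γ × A ≡ c B

Π : (ℕ → Set) → Hyps
Π V A = Σ ℕ λ p → V p × A ≡ (var p ∨' neg (var p))

data _⊢i_ (H : Hyps) : Formula → Set₁ where
  hyp  : ∀ {A} → H A → H ⊢i A
  ⊥E   : ∀ {A} → H ⊢i fls → H ⊢i A
  ∧I   : ∀ {A B} → H ⊢i A → H ⊢i B → H ⊢i (A ∧' B)
  ∧E₁  : ∀ {A B} → H ⊢i (A ∧' B) → H ⊢i A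
  ∧E₂  : ∀ {A B} → H ⊢i (A ∧' B) → H ⊢i B
  ∨I₁  : ∀ {A B} → H ⊢i A → H ⊢i (A ∨' B)
  ∨I₂  : ∀ {A B} → H ⊢i B → H ⊢i (A ∨' B)
  ∨E   : ∀ {A B C} → H ⊢i (A ∨' B) → (H ,, A) ⊢i C → (H ,, B) ⊢i C → H ⊢i C
  ⇒I   : ∀ {A B} → (H ,, A) ⊢i B → H ⊢i (A ⇒ B)
  ⇒E   : ∀ {A B} → H ⊢i (A ⇒ B) → H ⊢i A → H ⊢i B

data _⊢c_ (H : Hyps) : Formula → Set₁ where
  hyp  : ∀ {A} → H A → H ⊢c A
  ⊥E   : ∀ {A} → H ⊢c fls → H ⊢c A
  ∧I   : ∀ {A B} → H ⊢c A → H ⊢c B → H ⊢c (A ∧' B)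
  ∧E₁  : ∀ {A B} → H ⊢c (A ∧' B) → H ⊢c A
  ∧E₂  : ∀ {A B} → H ⊢c (A ∧' B) → H ⊢c B
  ∨I₁  : ∀ {A B} → H ⊢c A → H ⊢c (A ∨' B)
  ∨I₂  : ∀ {A B} → H ⊢c B → H ⊢c (A ∨' B)
  ∨E   : ∀ {A B C} → H ⊢c (A ∨' B) → (H ,, A) ⊢c C → (H ,, B) ⊢c C → H ⊢c C
  ⇒I   : ∀ {A B} → (H ,, A) ⊢c B → H ⊢c (A ⇒ B)
  ⇒E   : ∀ {A B} → H ⊢c (A ⇒ B) → H ⊢c A → H ⊢c B
  lem  : ∀ A → H ⊢c (A ∨' neg A)

⋁ : List Formula → Formula
⋁ []      = fls
⋁ (A ∷ Σ) = A ∨' ⋁ Σ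

mutual
  Vpos : Formula → ℕ → Set
  Vpos (var q)  p = p ≡ q
  Vpos fls      p = ⊥
  Vpos (A ∧' B) p = Vpos A p ⊎ Vpos B p
  Vpos (A ∨' B) p = Vpos A p ⊎ Vpos B p
  Vpos (A ⇒ B)  p = Vneg A p ⊎ Vpos B p

  Vneg : Formula → ℕ → Set
  Vneg (var q)  p = ⊥
  Vneg fls      p = ⊥
  Vneg (A ∧' B) p = Vneg A p ⊎ Vneg B p
  Vneg (A ∨' B) p = Vneg A p ⊎ Vneg B p
  Vneg (A ⇒ B)  p = Vpos A p ⊎ Vneg B p

Vposns : Formula → ℕ → Set
Vposns (var q)  p = ⊥
Vposns fls      p = ⊥
Vposns (A ∧' B) p = Vposns A p ⊎ Vposns B p
Vposns (A ∨' B) p = Vposns A p ⊎ Vposns B p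
Vposns (A ⇒ B)  p = Vneg A p ⊎ Vposns B p

lift : (Formula → ℕ → Set) → List Formula → ℕ → Set
lift f Γ p = Σ Formula λ B → B ∈ Γ × f B p

Occ : Formula → ℕ → Set
Occ (var q)  p = p ≡ q
Occ fls      p = ⊥
Occ (A ∧' B) p = Occ A p ⊎ Occ B p
Occ (A ∨' B) p = Occ A p ⊎ Occ B p
Occ (A ⇒ B)  p = Occ A p ⊎ Occ B p

{-# OPTIONS --safe #-}
-- By soundness for Boolean valuations, classical derivability of Γ, Δ ⇒ Σ makes the
-- signed sequent refutable: no valuation satisfies Γ and Δ while falsifying Σ. Such a
-- sequent is decomposed by the invertible rules of classical sequent calculus, each
-- replacing a formula by immediate subformulas that classically entail it. Throughout,
-- the translations A, ¬∗¬A, ¬∗A of the formulas of Γ, Δ, Σ stay intuitionistically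
-- derivable (on branching, under one extra hypothesis), and the set of variables for
-- which p ∨ ¬p is needed only shrinks. A refutable atomic sequent has some p both in Σ
-- and in Γ or Δ: then ¬∗p and p give ∗, or, for p in Δ, p ∨ ¬p splits into ¬∗p and
-- ¬∗¬p.
module Submission where

open import Defs
open import Data.Bool using (Bool; false; T)
open import Data.Bool.ListAction using (any)
open import Data.Empty using (⊥; ⊥-elim)
open import Data.List using (List; []; _∷_; _++_; map)
open import Data.List.Properties using (++-identityʳ)
open import Data.List.Membership.Propositional using (_∈_; find; lose)
open import Data.List.Relation.Unary.All as All using (All; []; _∷_)
open import Data.List.Relation.Unary.All.Properties using (++⁺; ++⁻ˡ; ++⁻ʳ; map⁺; map⁻; All¬⇒¬Any; ¬All⇒Any¬)
open import Data.List.Relation.Unary.Any using (Any; here; there)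
open import Data.List.Relation.Unary.Any.Properties as Any using (any⁺; any⁻)
open import Data.List.Relation.Binary.Permutation.Propositional using (_↭_; ↭-sym)
open import Data.List.Relation.Binary.Permutation.Propositional.Properties using (All-resp-↭; Any-resp-↭; shift)
open import Data.Nat using (ℕ; _≡ᵇ_)
open import Data.Nat.Properties using (≡ᵇ⇒≡; ≡⇒≡ᵇ)
open import Data.Product using (_×_; _,_; proj₁; proj₂; ∃)
open import Data.Sum as Sum using (_⊎_; inj₁; inj₂; [_,_])
open import Function using (_∘_)
open import Relation.Binary.PropositionalEquality using (refl; sym; subst)
open import Relation.Nullary using (¬_; Dec; no; ¬?)
open import Relation.Nullary.Decidable using (_×-dec_; _⊎-dec_; _→-dec_; toSum; decidable-stable; T?)
open import Relation.Unary using (_⊆_; _⊆′_; Decidable)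
open import Relation.Unary.Properties using (⊆′-refl)

Valuation : Set
Valuation = ℕ → Bool

_⊨_ : Valuation → Formula → Set
ρ ⊨ var p    = T (ρ p)
ρ ⊨ fls      = ⊥
ρ ⊨ (A ∧' B) = ρ ⊨ A × ρ ⊨ B
ρ ⊨ (A ∨' B) = ρ ⊨ A ⊎ ρ ⊨ B
ρ ⊨ (A ⇒ B)  = ρ ⊨ A → ρ ⊨ B

_⊨?_ : ∀ ρ A → Dec (ρ ⊨ A)
ρ ⊨? var p    = T? (ρ p)
ρ ⊨? fls      = no (λ ())
ρ ⊨? (A ∧' B) = (ρ ⊨? A) ×-dec (ρ ⊨? B)
ρ ⊨? (A ∨' B) = (ρ ⊨? A) ⊎-dec (ρ ⊨? B)
ρ ⊨? (A ⇒ B)  = (ρ ⊨? A) →-dec (ρ ⊨? B)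

_⊨ₕ_ : Valuation → Hyps → Set
ρ ⊨ₕ H = ∀ A → H A → ρ ⊨ A

⊨ₕ-,, : ∀ {ρ H A} → ρ ⊨ₕ H → ρ ⊨ A → ρ ⊨ₕ (H ,, A)
⊨ₕ-,, ⊨H a B (inj₁ h)    = ⊨H B h
⊨ₕ-,, ⊨H a B (inj₂ refl) = a

⊢c-sound : ∀ {ρ H A} → H ⊢c A → ρ ⊨ₕ H → ρ ⊨ A
⊢c-sound (hyp h)     ⊨H = ⊨H _ h
⊢c-sound (⊥E d)      ⊨H = ⊥-elim (⊢c-sound d ⊨H)
⊢c-sound (∧I d e)    ⊨H = ⊢c-sound d ⊨H , ⊢c-sound e ⊨H
⊢c-sound (∧E₁ d)     ⊨H = proj₁ (⊢c-sound d ⊨H)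
⊢c-sound (∧E₂ d)     ⊨H = proj₂ (⊢c-sound d ⊨H)
⊢c-sound (∨I₁ d)     ⊨H = inj₁ (⊢c-sound d ⊨H)
⊢c-sound (∨I₂ d)     ⊨H = inj₂ (⊢c-sound d ⊨H)
⊢c-sound (∨E d e f)  ⊨H =
  [ (λ a → ⊢c-sound e (⊨ₕ-,, ⊨H a)) , (λ b → ⊢c-sound f (⊨ₕ-,, ⊨H b)) ] (⊢c-sound d ⊨H)
⊢c-sound (⇒I d)      ⊨H = λ a → ⊢c-sound d (⊨ₕ-,, ⊨H a)
⊢c-sound (⇒E d e)    ⊨H = ⊢c-sound d ⊨H (⊢c-sound e ⊨H)
⊢c-sound {ρ} (lem A) ⊨H = toSum (ρ ⊨? A)

⊨⋁⇒Any : ∀ {ρ} Σ → ρ ⊨ ⋁ Σ → Any (ρ ⊨_) Σ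
⊨⋁⇒Any (A ∷ Σ) (inj₁ a) = here a
⊨⋁⇒Any (A ∷ Σ) (inj₂ s) = there (⊨⋁⇒Any Σ s)

,,-mono : ∀ {H K A} → H ⊆′ K → (H ,, A) ⊆′ (K ,, A)
,,-mono H⊆K B (inj₁ h) = inj₁ (H⊆K B h)
,,-mono H⊆K B (inj₂ e) = inj₂ e

⊆-,, : ∀ {H A} → H ⊆′ (H ,, A)
⊆-,, _ = inj₁

weaken : ∀ {H K A} → H ⊆′ K → H ⊢i A → K ⊢i A
weaken H⊆K (hyp h)    = hyp (H⊆K _ h)
weaken H⊆K (⊥E d)     = ⊥E (weaken H⊆K d)
weaken H⊆K (∧I d e)   = ∧I (weaken H⊆K d) (weaken H⊆K e)
weaken H⊆K (∧E₁ d)    = ∧E₁ (weaken H⊆K d)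
weaken H⊆K (∧E₂ d)    = ∧E₂ (weaken H⊆K d)
weaken H⊆K (∨I₁ d)    = ∨I₁ (weaken H⊆K d)
weaken H⊆K (∨I₂ d)    = ∨I₂ (weaken H⊆K d)
weaken H⊆K (∨E d e f) =
  ∨E (weaken H⊆K d) (weaken (,,-mono H⊆K) e) (weaken (,,-mono H⊆K) f)
weaken H⊆K (⇒I d)     = ⇒I (weaken (,,-mono H⊆K) d)
weaken H⊆K (⇒E d e)   = ⇒E (weaken H⊆K d) (weaken H⊆K e)

wk1 : ∀ {H A B} → H ⊢i A → (H ,, B) ⊢i A
wk1 = weaken ⊆-,,

#0 : ∀ {H A} → (H ,, A) ⊢i A
#0 = hyp (inj₂ refl)

#1 : ∀ {H A B} → ((H ,, A) ,, B) ⊢i A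
#1 = wk1 #0

#2 : ∀ {H A B C} → (((H ,, A) ,, B) ,, C) ⊢i A
#2 = wk1 #1

#3 : ∀ {H A B C D} → ((((H ,, A) ,, B) ,, C) ,, D) ⊢i A
#3 = wk1 #2

⇒-pre : ∀ {H A B C} → (H ,, A) ⊢i B → H ⊢i (B ⇒ C) → H ⊢i (A ⇒ C)
⇒-pre d h = ⇒I (⇒E (wk1 h) d)

-- γ, δ, σ mark membership in Γ, Δ, Σ.
data Side : Set where
  γ δ σ : Side

Signed : Set
Signed = Side × Formula

holds : Valuation → Signed → Set
holds ρ (γ , A) = ρ ⊨ A
holds ρ (δ , A) = ρ ⊨ A
holds ρ (σ , A) = ¬ ρ ⊨ A

holds? : ∀ ρ → Decidable (holds ρ)
holds? ρ (γ , A) = ρ ⊨? A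
holds? ρ (δ , A) = ρ ⊨? A
holds? ρ (σ , A) = ¬? (ρ ⊨? A)

Refutable : List Signed → Set
Refutable ℓ = ∀ ρ → ¬ All (holds ρ) ℓ

-- On the initial sequent these give the two sets of the theorem,
-- V⁻(Γ,Δ) ∪ V⁺(Σ) and V⁺ns(Γ) ∪ V⁺(Δ) ∪ V⁻(Σ).
V₁ V₂ : Signed → ℕ → Set
V₁ (γ , A) = Vneg A
V₁ (δ , A) = Vneg A
V₁ (σ , A) = Vpos A
V₂ (γ , A) = Vposns A
V₂ (δ , A) = Vpos A
V₂ (σ , A) = Vneg A

Occurs : (Signed → ℕ → Set) → List Signed → ℕ → Set
Occurs V ℓ p = Any (λ x → V x p) ℓ

Critical : List Signed → ℕ → Set
Critical ℓ p = Occurs V₁ ℓ p × Occurs V₂ ℓ p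

_≼_ : Signed → Signed → Set
y ≼ x = (V₁ y ⊆ V₁ x) × (V₂ y ⊆ V₂ x)

-- Every rule of `reduce` replaces a formula by signed immediate subformulas, with signs
-- chosen so that the left (right) one is ≼ the formula by inj₁ (inj₂).
pattern ≼ˡ = inj₁ , inj₁
pattern ≼ʳ = inj₂ , inj₂

Occurs-narrow : ∀ {V x} ys {M} → All (λ y → V y ⊆ V x) ys → Occurs V (ys ++ M) ⊆ Occurs V (x ∷ M)
Occurs-narrow []       []            i         = there i
Occurs-narrow (y ∷ ys) (y⊆x ∷ _)     (here v)  = here (y⊆x v)
Occurs-narrow (y ∷ ys) (_   ∷ ys⊆x)  (there i) = Occurs-narrow ys ys⊆x i

Critical-narrow : ∀ {x} ys {M} → All (_≼ x) ys → Critical (ys ++ M) ⊆ Critical (x ∷ M)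
Critical-narrow ys ys≼x (i , j) =
  Occurs-narrow ys (All.map proj₁ ys≼x) i , Occurs-narrow ys (All.map proj₂ ys≼x) j

data Atomic : Signed → Set where
  atom : ∀ s p → Atomic (s , var p)

Asserted : List Signed → ℕ → Set
Asserted ℓ p = (γ , var p) ∈ ℓ ⊎ (δ , var p) ∈ ℓ

Clash : List Signed → Set
Clash ℓ = ∃ λ p → (σ , var p) ∈ ℓ × Asserted ℓ p

asserts : ℕ → Signed → Bool
asserts p (γ , var q) = p ≡ᵇ q
asserts p (δ , var q) = p ≡ᵇ q
asserts p _           = false

atomsValuation : List Signed → Valuation
atomsValuation As p = any (asserts p) As

atomsValuation⁺ : ∀ {As p} → Asserted As p → T (atomsValuation As p)
atomsValuation⁺ {p = p} (inj₁ γ∈) = any⁺ (asserts p) (lose γ∈ (≡⇒≡ᵇ p p refl))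
atomsValuation⁺ {p = p} (inj₂ δ∈) = any⁺ (asserts p) (lose δ∈ (≡⇒≡ᵇ p p refl))

atomsValuation⁻ : ∀ {As p} → All Atomic As → T (atomsValuation As p) → Asserted As p
atomsValuation⁻ {As} {p} atomic t =
  let y , y∈As , asserts-y = find (any⁻ (asserts p) As t)
  in asserted (All.lookup atomic y∈As) y∈As asserts-y
  where
    asserted : ∀ {y} → Atomic y → y ∈ As → T (asserts p y) → Asserted As p
    asserted (atom γ q) y∈As p≡ᵇq rewrite ≡ᵇ⇒≡ p q p≡ᵇq = inj₁ y∈As
    asserted (atom δ q) y∈As p≡ᵇq rewrite ≡ᵇ⇒≡ p q p≡ᵇq = inj₂ y∈As

refutable-atoms-clash : ∀ {As} → All Atomic As → Refutable As → Clash As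
refutable-atoms-clash {As} atomic refutable =
  let x , x∈As , fails = find (¬All⇒Any¬ (holds? ρ) As (refutable ρ))
  in clash (All.lookup atomic x∈As) x∈As fails
  where
    ρ : Valuation
    ρ = atomsValuation As
    clash : ∀ {x} → Atomic x → x ∈ As → ¬ holds ρ x → Clash As
    clash (atom γ p) γ∈ fails = ⊥-elim (fails (atomsValuation⁺ (inj₁ γ∈)))
    clash (atom δ p) δ∈ fails = ⊥-elim (fails (atomsValuation⁺ (inj₂ δ∈)))
    clash (atom σ p) σ∈ fails = p , σ∈ , atomsValuation⁻ atomic (decidable-stable (T? (ρ p)) fails)

module Translation (S : Formula) where

  ⟪_⟫ : Signed → Formula
  ⟪ γ , A ⟫ = A
  ⟪ δ , A ⟫ = negS S (neg A)
  ⟪ σ , A ⟫ = negS S A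

  record Ready (H : Hyps) (ℓ : List Signed) : Set₁ where
    field
      refutable  : Refutable ℓ
      translated : All (λ x → H ⊢i ⟪ x ⟫) ℓ
      decided    : ∀ {p} → Critical ℓ p → H ⊢i (var p ∨' neg (var p))

  open Ready

  Closes : List Signed → Set₁
  Closes ℓ = ∀ {H} → Ready H ℓ → H ⊢i S

  Ready-resp-↭ : ∀ {H ℓ ℓ'} → ℓ ↭ ℓ' → Ready H ℓ → Ready H ℓ'
  Ready-resp-↭ ℓ↭ℓ' r = record
    { refutable  = λ ρ → refutable r ρ ∘ All-resp-↭ (↭-sym ℓ↭ℓ')
    ; translated = All-resp-↭ ℓ↭ℓ' (translated r)
    ; decided    = λ (i , j) → decided r (Any-resp-↭ (↭-sym ℓ↭ℓ') i , Any-resp-↭ (↭-sym ℓ↭ℓ') j)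
    }

  refine : ∀ {H K x ys M}
    → (∀ {ρ} → All (holds ρ) ys → holds ρ x) → All (_≼ x) ys
    → H ⊆′ K → All (λ y → K ⊢i ⟪ y ⟫) ys
    → Ready H (x ∷ M) → Ready K (ys ++ M)
  refine {ys = ys} entails ys≼x H⊆K ⊢ys r = record
    { refutable  = λ ρ ⊨ys++M → refutable r ρ (entails (++⁻ˡ ys ⊨ys++M) ∷ ++⁻ʳ ys ⊨ys++M)
    ; translated = ++⁺ ⊢ys (All.map (weaken H⊆K) (All.tail (translated r)))
    ; decided    = weaken H⊆K ∘ decided r ∘ Critical-narrow ys ys≼x
    }

  principal : ∀ {H x M} → Ready H (x ∷ M) → H ⊢i ⟪ x ⟫
  principal = All.head ∘ translated

  clash-closes : ∀ {ℓ} → Clash ℓ → Closes ℓ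
  clash-closes (p , σ∈ , inj₁ γ∈) r =
    ⇒E (All.lookup (translated r) σ∈) (All.lookup (translated r) γ∈)
  clash-closes (p , σ∈ , inj₂ δ∈) r =
    ∨E (decided r (lose σ∈ refl , lose δ∈ refl))
       (⇒E (wk1 (All.lookup (translated r) σ∈)) #0)
       (⇒E (wk1 (All.lookup (translated r) δ∈)) #0)

  atoms-close : ∀ {As} → All Atomic As → Closes As
  atoms-close atomic r = clash-closes (refutable-atoms-clash atomic (refutable r)) r

  -- Continuation passing makes `reduce` structurally recursive on the formula it
  -- decomposes; As collects the atoms met so far.
  Cont : List Signed → Set₁
  Cont L = ∀ {As} → All Atomic As → Closes (L ++ As)

  skip : ∀ {x L} → Atomic x → Cont L → Cont (x ∷ L)
  skip {x} {L} a k {As} atomic r = k (a ∷ atomic) (Ready-resp-↭ (↭-sym (shift x L As)) r)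

  -- In the branching rules other than γ ∨, the branch closed under an extra hypothesis C
  -- proves C ⇒ S, the translation of the formula added in the other branch.
  reduce : ∀ s A {L} → Cont L → Cont ((s , A) ∷ L)
  reduce-γ : ∀ A {L} → Cont L → Cont ((γ , A) ∷ L)
  reduce-δ : ∀ A {L} → Cont L → Cont ((δ , A) ∷ L)
  reduce-σ : ∀ A {L} → Cont L → Cont ((σ , A) ∷ L)

  reduce γ = reduce-γ
  reduce δ = reduce-δ
  reduce σ = reduce-σ

  reduce-γ (var p) = skip (atom γ p)
  reduce-γ fls k atomic r = ⊥E (principal r)
  reduce-γ (A ∧' B) k atomic r =
    reduce γ A (reduce γ B k) atomic
      (refine (λ { (a ∷ b ∷ []) → a , b }) (≼ˡ ∷ ≼ʳ ∷ []) ⊆′-refl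
        (∧E₁ (principal r) ∷ ∧E₂ (principal r) ∷ []) r)
  reduce-γ (A ∨' B) k atomic r =
    ∨E (principal r)
      (reduce γ A k atomic (refine (λ { (a ∷ []) → inj₁ a }) (≼ˡ ∷ []) ⊆-,, (#0 ∷ []) r))
      (reduce γ B k atomic (refine (λ { (b ∷ []) → inj₂ b }) (≼ʳ ∷ []) ⊆-,, (#0 ∷ []) r))
  reduce-γ (A ⇒ B) k atomic {H} r =
    reduce σ A k atomic
      (refine (λ { (¬a ∷ []) a → ⊥-elim (¬a a) }) (≼ˡ ∷ []) ⊆′-refl (⇒I given-A ∷ []) r)
    where
      given-A : (H ,, A) ⊢i S
      given-A = reduce γ B k atomic
        (refine (λ { (b ∷ []) _ → b }) (≼ʳ ∷ []) ⊆-,, (⇒E (wk1 (principal r)) #0 ∷ []) r)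

  reduce-δ (var p) = skip (atom δ p)
  reduce-δ fls k atomic r = ⇒E (principal r) (⇒I #0)
  reduce-δ (A ∧' B) k atomic r =
    reduce δ A (reduce δ B k) atomic
      (refine (λ { (a ∷ b ∷ []) → a , b }) (≼ˡ ∷ ≼ʳ ∷ []) ⊆′-refl
        (⇒-pre (⇒I (⇒E #1 (∧E₁ #0))) (principal r) ∷
         ⇒-pre (⇒I (⇒E #1 (∧E₂ #0))) (principal r) ∷ []) r)
  reduce-δ (A ∨' B) k atomic {H} r =
    reduce δ A k atomic
      (refine (λ { (a ∷ []) → inj₁ a }) (≼ˡ ∷ []) ⊆′-refl (⇒I given-¬A ∷ []) r)
    where
      given-¬A : (H ,, neg A) ⊢i S
      given-¬A = reduce δ B k atomic
        (refine (λ { (b ∷ []) → inj₂ b }) (≼ʳ ∷ []) ⊆-,,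
          (⇒-pre (⇒I (∨E #0 (⇒E #3 #0) (⇒E #2 #0))) (wk1 (principal r)) ∷ []) r)
  reduce-δ (A ⇒ B) k atomic {H} r =
    reduce σ A k atomic
      (refine (λ { (¬a ∷ []) a → ⊥-elim (¬a a) }) (≼ˡ ∷ []) ⊆′-refl (⇒I given-A ∷ []) r)
    where
      given-A : (H ,, A) ⊢i S
      given-A = reduce δ B k atomic
        (refine (λ { (b ∷ []) _ → b }) (≼ʳ ∷ []) ⊆-,,
          (⇒-pre (⇒I (⇒E #1 (⇒E #0 #2))) (wk1 (principal r)) ∷ []) r)

  reduce-σ (var p) = skip (atom σ p)
  reduce-σ fls k atomic r = k atomic (refine (λ _ ()) [] ⊆′-refl [] r)
  reduce-σ (A ∧' B) k atomic {H} r =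
    reduce σ A k atomic
      (refine (λ { (¬a ∷ []) (a , _) → ¬a a }) (≼ˡ ∷ []) ⊆′-refl (⇒I given-A ∷ []) r)
    where
      given-A : (H ,, A) ⊢i S
      given-A = reduce σ B k atomic
        (refine (λ { (¬b ∷ []) (_ , b) → ¬b b }) (≼ʳ ∷ []) ⊆-,,
          (⇒-pre (∧I #1 #0) (wk1 (principal r)) ∷ []) r)
  reduce-σ (A ∨' B) k atomic r =
    reduce σ A (reduce σ B k) atomic
      (refine (λ { (¬a ∷ ¬b ∷ []) → [ ¬a , ¬b ] }) (≼ˡ ∷ ≼ʳ ∷ []) ⊆′-refl
        (⇒-pre (∨I₁ #0) (principal r) ∷ ⇒-pre (∨I₂ #0) (principal r) ∷ []) r)
  reduce-σ (A ⇒ B) k atomic r =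
    reduce δ A (reduce σ B k) atomic
      (refine (λ { (a ∷ ¬b ∷ []) f → ¬b (f a) }) (≼ˡ ∷ ≼ʳ ∷ []) ⊆′-refl
        (⇒-pre (⇒I (⊥E (⇒E #1 #0))) (principal r) ∷ ⇒-pre (⇒I #1) (principal r) ∷ []) r)

  reduce-all : ∀ L → Cont L
  reduce-all []            = atoms-close
  reduce-all ((s , A) ∷ L) = reduce s A (reduce-all L)

  closes : ∀ ℓ → Closes ℓ
  closes ℓ r = reduce-all ℓ [] (subst (Ready _) (sym (++-identityʳ ℓ)) r)

signed : List Formula → List Formula → List Formula → List Signed
signed Γ Δ Σ = map (γ ,_) Γ ++ map (δ ,_) Δ ++ map (σ ,_) Σ

signed-refutable : ∀ Γ Δ Σ → ⟦ Γ ++ Δ ⟧ ⊢c ⋁ Σ → Refutable (signed Γ Δ Σ)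
signed-refutable Γ Δ Σ ⊢Σ ρ ⊨ℓ =
  All¬⇒¬Any ⊭Σ (⊨⋁⇒Any Σ (⊢c-sound ⊢Σ (λ _ → All.lookup (++⁺ ⊨Γ ⊨Δ))))
  where
    ⊨Γ : All (ρ ⊨_) Γ
    ⊨Γ = map⁻ (++⁻ˡ (map (γ ,_) Γ) ⊨ℓ)
    ⊨Δ : All (ρ ⊨_) Δ
    ⊨Δ = map⁻ (++⁻ˡ (map (δ ,_) Δ) (++⁻ʳ (map (γ ,_) Γ) ⊨ℓ))
    ⊭Σ : All (¬_ ∘ (ρ ⊨_)) Σ
    ⊭Σ = map⁻ (++⁻ʳ (map (δ ,_) Δ) (++⁻ʳ (map (γ ,_) Γ) ⊨ℓ))

All-signed : ∀ {ℓ} {P : Signed → Set ℓ} Γ Δ Σ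
  → (∀ {A} → A ∈ Γ → P (γ , A)) → (∀ {A} → A ∈ Δ → P (δ , A)) → (∀ {A} → A ∈ Σ → P (σ , A))
  → All P (signed Γ Δ Σ)
All-signed Γ Δ Σ pΓ pΔ pΣ =
  ++⁺ {xs = map (γ ,_) Γ} (map⁺ (All.tabulate pΓ))
      (++⁺ {xs = map (δ ,_) Δ} (map⁺ (All.tabulate pΔ)) (map⁺ (All.tabulate pΣ)))

Occurs-signed : ∀ {V p} Γ Δ Σ → Occurs V (signed Γ Δ Σ) p
  → Any (λ A → V (γ , A) p) Γ ⊎ Any (λ A → V (δ , A) p) Δ ⊎ Any (λ A → V (σ , A) p) Σ
Occurs-signed Γ Δ Σ i with Any.++⁻ (map (γ ,_) Γ) i
... | inj₁ iΓ = inj₁ (Any.map⁻ iΓ)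
... | inj₂ i′ = inj₂ (Sum.map Any.map⁻ Any.map⁻ (Any.++⁻ (map (δ ,_) Δ) i′))

proposition3p1 : (s : ℕ) (Γ Δ Σ : List Formula) (V : ℕ → Set)
    → ¬ lift Occ (Γ ++ Δ ++ Σ) s
    → ⟦ Γ ++ Δ ⟧ ⊢c ⋁ Σ
    → (∀ p → (lift Vneg (Γ ++ Δ) p ⊎ lift Vpos Σ p)
           → (lift Vposns Γ p ⊎ lift Vpos Δ p ⊎ lift Vneg Σ p)
           → V p)
    → (Π V ∪H (⟦ Γ ⟧ ∪H (mapH (λ D → negS (var s) (neg D)) Δ ∪H mapH (negS (var s)) Σ))) ⊢i var s
proposition3p1 s Γ Δ Σ V _ ⊢Σ critical⊆V = closes (signed Γ Δ Σ) record
  { refutable  = signed-refutable Γ Δ Σ ⊢Σ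
  ; translated = All-signed Γ Δ Σ (λ A∈Γ → hyp (inj₂ (inj₁ A∈Γ)))
                     (λ A∈Δ → hyp (inj₂ (inj₂ (inj₁ (_ , A∈Δ , refl)))))
                     (λ A∈Σ → hyp (inj₂ (inj₂ (inj₂ (_ , A∈Σ , refl)))))
  ; decided    = λ {p} (i , j) → hyp (inj₁ (p , critical⊆V p (fromV₁ i) (fromV₂ j) , refl))
  }
  where
    open Translation (var s)
    fromV₁ : ∀ {p} → Occurs V₁ (signed Γ Δ Σ) p → lift Vneg (Γ ++ Δ) p ⊎ lift Vpos Σ p
    fromV₁ = [ inj₁ ∘ find ∘ Any.++⁺ˡ , [ inj₁ ∘ find ∘ Any.++⁺ʳ Γ , inj₂ ∘ find ] ]
           ∘ Occurs-signed {V = V₁} Γ Δ Σ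
    fromV₂ : ∀ {p} → Occurs V₂ (signed Γ Δ Σ) p → lift Vposns Γ p ⊎ lift Vpos Δ p ⊎ lift Vneg Σ p
    fromV₂ = Sum.map find (Sum.map find find) ∘ Occurs-signed {V = V₂} Γ Δ Σ
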